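{- Given a normal $S3^\forall_\equiv$-model $\mathcal{M}$ and assignment $\gamma$, the relation $\varphi\approx_i\psi:\Leftrightarrow(\mathcal{M},\gamma)\vDash\varphi\equiv\psi$ (propositional identity) is a congruence relation on $Fm(C)$ (w.r.t. $\neg,\vee,\wedge,\rightarrow,\square,\equiv$) containing alpha-congruence; the relation $\varphi\approx_s\psi:\Leftrightarrow(\mathcal{M},\gamma)\vDash\square(\varphi\rightarrow\psi)\wedge\square(\psi\rightarrow\varphi)$ (strict equivalence) is an equivalence relation on $Fm(C)$. Moreover, propositional identity refines strict equivalence: $\Vdash_3(\varphi\equiv\psi)\rightarrow(\square(\varphi\rightarrow\psi)\wedge\square(\psi\rightarrow\varphi))$.
   Context: Language: $Fm(C)$ is the set of formulas built from propositional variables $V$, a set $C$ of propositional constants containing $\top,\bot$, connectives $\neg,\rightarrow,\vee,\wedge$, identity connective $\equiv$, necessity $\square$ and universal propositional quantifier $\forall$. Alpha-congruence $=_\alpha$: formulas differing only in bound variables. Semantics: a propositional domain is $\mathcal{M}=(M,\mathit{TRUE},\mathit{NEC},f_\bot,f_\top,f_\square,f_\neg,f_\vee,f_\wedge,f_\rightarrow,f_\equiv,f_\forall,\varGamma)$ with $\mathit{TRUE},\mathit{NEC}\subseteq M$, operations of obvious arities, $f_\forall\colon M^M\to M$, $\varGamma\colon C\to M$ with $\varGamma(\bot)=f_\bot,\varGamma(\top)=f_\top$; assignments $\gamma\colon V\to M$ extend homomorphically with $\gamma(c)=\varGamma(c)$ and $\gamma(\forall x\varphi)=f_\forall(m\mapsto\gamma_x^m(\varphi))$.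 $t\colon M\to M$ is $(\varphi,x,\gamma)$-definable if $t(m)=\gamma_x^m(\varphi)$ for all $m$ (definable if so for some $\varphi,x,\gamma$). With $a\le_\mathcal{M}b:\Leftrightarrow f_\rightarrow(a,b)\in\mathit{NEC}$ and $\approx_\mathcal{M}$ its symmetric part, $\mathcal{M}$ is an $S3^\forall_\equiv$-model if: (1) when $\mathit{NEC}\neq\varnothing$, $\le_\mathcal{M}$ is a preorder making $(M,f_\bot,f_\top,f_\neg,f_\vee,f_\wedge,f_\rightarrow,\le_\mathcal{M})$ a Boolean prealgebra ($\approx_\mathcal{M}$ a congruence with Boolean-algebra quotient ordered by $\le_\mathcal{M}$); (2) $f_\bot\notin\mathit{TRUE}$, $f_\top\in\mathit{TRUE}$, classical truth conditions for $f_\rightarrow,f_\neg,f_\wedge,f_\vee$, $f_\square(a)\in\mathit{TRUE}\Leftrightarrow a\in\mathit{NEC}$, $f_\equiv(a,b)\in\mathit{TRUE}\Leftrightarrow a=b$, $f_\forall(t)\in\mathit{TRUE}$ for definable $t$ with image in $\mathit{TRUE}$; (3) when $\mathit{NEC}\neq\varnothing$, $\mathit{NEC}\subseteq\mathit{TRUE}$ is upward closed under $\le_\mathcal{M}$ and closed under $f_\wedge$; (4) when $\mathit{NEC}\neq\varnothing$: $f_\top\le_\mathcal{M}f_\equiv(a,a)$; $f_\equiv(a,b)\le_\mathcal{M}f_\rightarrow(a,b)$; $f_\equiv(a,b)\le_\mathcal{M}f_\equiv(t(a),t(b))$ for definable $t$; $f_\square(a)\le_\mathcal{M}a$; $f_\square(f_\rightarrow(a,b))\le_\mathcal{M}f_\rightarrow(f_\square(a),f_\square(b))$;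 $f_\square(f_\rightarrow(a,b))\le_\mathcal{M}f_\square(f_\rightarrow(f_\square(a),f_\square(b)))$; $f_\forall(t)\le_\mathcal{M}f_\equiv(f_\forall(t_1),f_\forall(t_2))$ and $f_\forall(t)\le_\mathcal{M}f_\rightarrow(f_\forall(t_1),f_\forall(t_2))$ for $t_1,t_2$ $(\varphi,x,\gamma)$-, $(\psi,x,\gamma)$-definable and $t$ the pointwise $f_\equiv$, resp. $f_\rightarrow$, of $t_1,t_2$; $f_\forall(t)\le_\mathcal{M}t(a)$ for definable $t$; $f_\forall(t)\le_\mathcal{M}f_\rightarrow(b,f_\forall(t'))$ for $t'$ $(\psi,x,\gamma)$-definable, $b$ the denotation of a sentence and $t(a)=f_\rightarrow(b,t'(a))$; $f_\square(f_\forall(t))\approx_\mathcal{M}f_\forall(a\mapsto f_\square(t(a)))$ for definable $t$; $f_\forall(t)\in\mathit{NEC}$ for definable $t$ with image in $\mathit{NEC}$. It is normal if $\mathit{NEC}\neq\varnothing$. $(\mathcal{M},\gamma)\vDash\varphi:\Leftrightarrow\gamma(\varphi)\in\mathit{TRUE}$; $\Vdash_3\varphi$ means $\varphi$ is true in every normal $S3^\forall_\equiv$-model under every assignment. -}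

module Defs where

open import Level using (0ℓ)
open import Data.Nat using (ℕ; _≟_)
open import Data.Product using (Σ; _×_; _,_)
open import Data.Sum using (_⊎_)
open import Data.Empty using (⊥)
open import Data.List using (List; []; _∷_)
open import Relation.Nullary using (¬_; yes; no)
open import Relation.Binary.PropositionalEquality using (_≡_; _≢_)
open import Relation.Binary.Structures using (IsPreorder)
open import Function.Bundles using (_⇔_)
import Algebra.Lattice.Structures as LS

Var : Set
Var = ℕ

infixr 6 _⇒_
infixr 7 _∨'_
infixr 8 _∧'_
infix 9 _≡'_

data Fm (C : Set) : Set where
  var  : Var → Fm C
  con  : C → Fm C
  ⊤'   : Fm C
  ⊥'   : Fm C
  ¬'   : Fm C → Fm C
  _⇒_  : Fm C → Fm C → Fm C
  _∨'_ : Fm C → Fm C → Fm C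
  _∧'_ : Fm C → Fm C → Fm C
  _≡'_ : Fm C → Fm C → Fm C
  □    : Fm C → Fm C
  ∀'   : Var → Fm C → Fm C

data FreeIn {C : Set} (x : Var) : Fm C → Set where
  frvar  : FreeIn x (var x)
  fr¬    : ∀ {φ} → FreeIn x φ → FreeIn x (¬' φ)
  fr⇒l   : ∀ {φ ψ} → FreeIn x φ → FreeIn x (φ ⇒ ψ)
  fr⇒r   : ∀ {φ ψ} → FreeIn x ψ → FreeIn x (φ ⇒ ψ)
  fr∨l   : ∀ {φ ψ} → FreeIn x φ → FreeIn x (φ ∨' ψ)
  fr∨r   : ∀ {φ ψ} → FreeIn x ψ → FreeIn x (φ ∨' ψ)
  fr∧l   : ∀ {φ ψ} → FreeIn x φ → FreeIn x (φ ∧' ψ)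
  fr∧r   : ∀ {φ ψ} → FreeIn x ψ → FreeIn x (φ ∧' ψ)
  fr≡l   : ∀ {φ ψ} → FreeIn x φ → FreeIn x (φ ≡' ψ)
  fr≡r   : ∀ {φ ψ} → FreeIn x ψ → FreeIn x (φ ≡' ψ)
  fr□    : ∀ {φ} → FreeIn x φ → FreeIn x (□ φ)
  fr∀    : ∀ {y φ} → x ≢ y → FreeIn x φ → FreeIn x (∀' y φ)

Sentence : {C : Set} → Fm C → Set
Sentence φ = ∀ x → ¬ FreeIn x φ

-- Alpha-congruence (standard definition with a context of pairs of
-- simultaneously bound variables, innermost binder first).

data VarRel : List (Var × Var) → Var → Var → Set where
  free  : ∀ {x} → VarRel [] x x
  here  : ∀ {x y ρ} → VarRel ((x , y) ∷ ρ) x y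
  there : ∀ {x y a b ρ} → x ≢ a → y ≢ b → VarRel ρ x y → VarRel ((a , b) ∷ ρ) x y

data AlphaRel {C : Set} : List (Var × Var) → Fm C → Fm C → Set where
  avar : ∀ {ρ x y} → VarRel ρ x y → AlphaRel ρ (var x) (var y)
  acon : ∀ {ρ c} → AlphaRel ρ (con c) (con c)
  a⊤   : ∀ {ρ} → AlphaRel ρ ⊤' ⊤'
  a⊥   : ∀ {ρ} → AlphaRel ρ ⊥' ⊥'
  a¬   : ∀ {ρ φ φ'} → AlphaRel ρ φ φ' → AlphaRel ρ (¬' φ) (¬' φ')
  a⇒   : ∀ {ρ φ φ' ψ ψ'} → AlphaRel ρ φ φ' → AlphaRel ρ ψ ψ' → AlphaRel ρ (φ ⇒ ψ) (φ' ⇒ ψ')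
  a∨   : ∀ {ρ φ φ' ψ ψ'} → AlphaRel ρ φ φ' → AlphaRel ρ ψ ψ' → AlphaRel ρ (φ ∨' ψ) (φ' ∨' ψ')
  a∧   : ∀ {ρ φ φ' ψ ψ'} → AlphaRel ρ φ φ' → AlphaRel ρ ψ ψ' → AlphaRel ρ (φ ∧' ψ) (φ' ∧' ψ')
  a≡   : ∀ {ρ φ φ' ψ ψ'} → AlphaRel ρ φ φ' → AlphaRel ρ ψ ψ' → AlphaRel ρ (φ ≡' ψ) (φ' ≡' ψ')
  a□   : ∀ {ρ φ φ'} → AlphaRel ρ φ φ' → AlphaRel ρ (□ φ) (□ φ')
  a∀   : ∀ {ρ x y φ ψ} → AlphaRel ((x , y) ∷ ρ) φ ψ → AlphaRel ρ (∀' x φ) (∀' y ψ)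

infix 4 _=α_
_=α_ : {C : Set} → Fm C → Fm C → Set
φ =α ψ = AlphaRel [] φ ψ

-- TRUE and NEC are subsets (predicates) of M.
-- f∀-ext records that f∀ is a function on the function space M^M, i.e.
-- it respects pointwise equality of functions (automatic set-theoretically).

record PropDomain (C : Set) : Set₁ where
  field
    M    : Set
    TRUE : M → Set
    NEC  : M → Set
    f⊥ f⊤ : M
    f□ f¬ : M → M
    f∨ f∧ f→ f≡ : M → M → M
    f∀   : (M → M) → M
    f∀-ext : ∀ {t t' : M → M} → (∀ m → t m ≡ t' m) → f∀ t ≡ f∀ t'
    Γ    : C → M

module _ {C : Set} (𝓜 : PropDomain C) where
  open PropDomain 𝓜

  Assignment : Set
  Assignment = Var → M

  update : Assignment → Var → M → Assignment
  update γ x m y with y ≟ x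
  ... | yes _ = m
  ... | no  _ = γ y

  ⟦_⟧ : Fm C → Assignment → M
  ⟦ var x ⟧ γ = γ x
  ⟦ con c ⟧ γ = Γ c
  ⟦ ⊤' ⟧ γ = f⊤
  ⟦ ⊥' ⟧ γ = f⊥
  ⟦ ¬' φ ⟧ γ = f¬ (⟦ φ ⟧ γ)
  ⟦ φ ⇒ ψ ⟧ γ = f→ (⟦ φ ⟧ γ) (⟦ ψ ⟧ γ)
  ⟦ φ ∨' ψ ⟧ γ = f∨ (⟦ φ ⟧ γ) (⟦ ψ ⟧ γ)
  ⟦ φ ∧' ψ ⟧ γ = f∧ (⟦ φ ⟧ γ) (⟦ ψ ⟧ γ)
  ⟦ φ ≡' ψ ⟧ γ = f≡ (⟦ φ ⟧ γ) (⟦ ψ ⟧ γ)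
  ⟦ □ φ ⟧ γ = f□ (⟦ φ ⟧ γ)
  ⟦ ∀' x φ ⟧ γ = f∀ (λ m → ⟦ φ ⟧ (update γ x m))

  DefinableBy : (M → M) → Fm C → Var → Assignment → Set
  DefinableBy t φ x γ = ∀ m → t m ≡ ⟦ φ ⟧ (update γ x m)

  Definable : (M → M) → Set
  Definable t = Σ (Fm C) λ φ → Σ Var λ x → Σ Assignment λ γ → DefinableBy t φ x γ

  SentenceDenotation : M → Set
  SentenceDenotation b = Σ (Fm C) λ χ → Σ Assignment λ γ → Sentence χ × b ≡ ⟦ χ ⟧ γ

  NECnonempty : Set
  NECnonempty = Σ M NEC

  _≤M_ : M → M → Set
  a ≤M b = NEC (f→ a b)

  _≈M_ : M → M → Set
  a ≈M b = (a ≤M b) × (b ≤M a)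

  record IsS3Model : Set where
    field
      preorder   : NECnonempty → IsPreorder _≡_ _≤M_
      boolean    : NECnonempty → LS.IsBooleanAlgebra _≈M_ f∨ f∧ f¬ f⊤ f⊥
      ≤-is-order : NECnonempty → ∀ a b → (a ≤M b) ⇔ (f∧ a b ≈M a)
      →-boolean  : NECnonempty → ∀ a b → f→ a b ≈M f∨ (f¬ a) b
      ⊥-false : ¬ TRUE f⊥
      ⊤-true  : TRUE f⊤
      →-truth : ∀ a b → TRUE (f→ a b) ⇔ (TRUE a → TRUE b)
      ¬-truth : ∀ a → TRUE (f¬ a) ⇔ (¬ TRUE a)
      ∧-truth : ∀ a b → TRUE (f∧ a b) ⇔ (TRUE a × TRUE b)
      ∨-truth : ∀ a b → TRUE (f∨ a b) ⇔ (TRUE a ⊎ TRUE b)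
      □-truth : ∀ a → TRUE (f□ a) ⇔ NEC a
      ≡-truth : ∀ a b → TRUE (f≡ a b) ⇔ (a ≡ b)
      ∀-truth : ∀ t → Definable t → (∀ m → TRUE (t m)) → TRUE (f∀ t)
      NEC⊆TRUE : NECnonempty → ∀ a → NEC a → TRUE a
      NEC-up   : NECnonempty → ∀ a b → NEC a → a ≤M b → NEC b
      NEC-∧    : NECnonempty → ∀ a b → NEC a → NEC b → NEC (f∧ a b)
      ≡-refl  : NECnonempty → ∀ a → f⊤ ≤M f≡ a a
      ≡-→     : NECnonempty → ∀ a b → f≡ a b ≤M f→ a b
      ≡-subst : NECnonempty → ∀ t → Definable t → ∀ a b → f≡ a b ≤M f≡ (t a) (t b)
      □-T     : NECnonempty → ∀ a → f□ a ≤M a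
      □-K     : NECnonempty → ∀ a b → f□ (f→ a b) ≤M f→ (f□ a) (f□ b)
      □-S3    : NECnonempty → ∀ a b → f□ (f→ a b) ≤M f□ (f→ (f□ a) (f□ b))
      ∀-≡     : NECnonempty → ∀ φ ψ x γ t₁ t₂ t → DefinableBy t₁ φ x γ → DefinableBy t₂ ψ x γ →
                (∀ m → t m ≡ f≡ (t₁ m) (t₂ m)) → f∀ t ≤M f≡ (f∀ t₁) (f∀ t₂)
      ∀-→     : NECnonempty → ∀ φ ψ x γ t₁ t₂ t → DefinableBy t₁ φ x γ → DefinableBy t₂ ψ x γ →
                (∀ m → t m ≡ f→ (t₁ m) (t₂ m)) → f∀ t ≤M f→ (f∀ t₁) (f∀ t₂)
      ∀-inst  : NECnonempty → ∀ t → Definable t → ∀ a → f∀ t ≤M t a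
      ∀-vac   : NECnonempty → ∀ ψ x γ t t' b → DefinableBy t' ψ x γ → SentenceDenotation b →
                (∀ a → t a ≡ f→ b (t' a)) → f∀ t ≤M f→ b (f∀ t')
      □-∀     : NECnonempty → ∀ t → Definable t → f□ (f∀ t) ≈M f∀ (λ a → f□ (t a))
      ∀-NEC   : NECnonempty → ∀ t → Definable t → (∀ m → NEC (t m)) → NEC (f∀ t)

  _⊨_ : Assignment → Fm C → Set
  γ ⊨ φ = TRUE (⟦ φ ⟧ γ)

Normal : {C : Set} → PropDomain C → Set
Normal 𝓜 = NECnonempty 𝓜

⊩₃ : {C : Set} → Fm C → Set₁
⊩₃ {C} φ = (𝓜 : PropDomain C) → IsS3Model 𝓜 → Normal 𝓜 → (γ : Assignment 𝓜) → _⊨_ 𝓜 γ φ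

Rel : Set → Set₁
Rel A = A → A → Set

record IsEquivalenceRel {A : Set} (R : Rel A) : Set where
  field
    refl  : ∀ x → R x x
    sym   : ∀ {x y} → R x y → R y x
    trans : ∀ {x y z} → R x y → R y z → R x z

record IsFmCongruence {C : Set} (R : Rel (Fm C)) : Set where
  field
    isEquivalence : IsEquivalenceRel R
    ¬-cong : ∀ {φ φ'} → R φ φ' → R (¬' φ) (¬' φ')
    ∨-cong : ∀ {φ φ' ψ ψ'} → R φ φ' → R ψ ψ' → R (φ ∨' ψ) (φ' ∨' ψ')
    ∧-cong : ∀ {φ φ' ψ ψ'} → R φ φ' → R ψ ψ' → R (φ ∧' ψ) (φ' ∧' ψ')
    ⇒-cong : ∀ {φ φ' ψ ψ'} → R φ φ' → R ψ ψ' → R (φ ⇒ ψ) (φ' ⇒ ψ')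
    □-cong : ∀ {φ φ'} → R φ φ' → R (□ φ) (□ φ')
    ≡-cong : ∀ {φ φ' ψ ψ'} → R φ φ' → R ψ ψ' → R (φ ≡' ψ) (φ' ≡' ψ')

strictEquiv : {C : Set} → Fm C → Fm C → Fm C
strictEquiv φ ψ = □ (φ ⇒ ψ) ∧' □ (ψ ⇒ φ)

≈ᵢ : {C : Set} (𝓜 : PropDomain C) → Assignment 𝓜 → Rel (Fm C)
≈ᵢ 𝓜 γ φ ψ = _⊨_ 𝓜 γ (φ ≡' ψ)

≈ₛ : {C : Set} (𝓜 : PropDomain C) → Assignment 𝓜 → Rel (Fm C)
≈ₛ 𝓜 γ φ ψ = _⊨_ 𝓜 γ (strictEquiv φ ψ)

-- Propositional identity is interpreted as equality of denotations, so ≈ᵢ is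
-- the kernel of γ-evaluation and inherits all congruence properties of
-- equality; alpha-congruent formulas denote the same element because
-- evaluation only looks at bound variables through the assignments they
-- update.  Strict equivalence is true exactly when the denotations are
-- equivalent under the preorder ≤M of the (normal) model, which makes ≈ₛ an
-- equivalence relation and, by reflexivity, coarser than ≈ᵢ.
module Submission where

open import Defs
open import Data.Product using (_×_; _,_; swap)
open import Data.Nat using (_≟_)
open import Data.List using (List; []; _∷_)
open import Data.Empty using (⊥-elim)
open import Relation.Nullary using (yes; no)
open import Relation.Binary.PropositionalEquality as ≡ using (_≡_; refl)
open import Relation.Binary.Structures using (IsPreorder)
open import Function.Bundles using (_⇔_; mk⇔; Equivalence)
open Equivalence using (to; from)

module AlphaInvariance {C : Set} (𝓜 : PropDomain C) where
  open PropDomain 𝓜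

  Agree : List (Var × Var) → Assignment 𝓜 → Assignment 𝓜 → Set
  Agree ρ γ₁ γ₂ = ∀ {x y} → VarRel ρ x y → γ₁ x ≡ γ₂ y

  Agree-[] : ∀ {γ} → Agree [] γ γ
  Agree-[] free = refl

  Agree-update : ∀ {ρ γ₁ γ₂} x y m → Agree ρ γ₁ γ₂ →
                 Agree ((x , y) ∷ ρ) (update 𝓜 γ₁ x m) (update 𝓜 γ₂ y m)
  Agree-update x y m agree (here {x = x'}) with x' ≟ x | y ≟ y
  ... | yes _    | yes _   = refl
  ... | no x'≢x  | _       = ⊥-elim (x'≢x refl)
  ... | _        | no y≢y  = ⊥-elim (y≢y refl)
  Agree-update x y m agree (there {x = x'} {y = y'} x'≢x y'≢y r) with x' ≟ x | y' ≟ y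
  ... | yes x'≡x | _        = ⊥-elim (x'≢x x'≡x)
  ... | no _     | yes y'≡y = ⊥-elim (y'≢y y'≡y)
  ... | no _     | no _     = agree r

  ⟦⟧-respects-AlphaRel : ∀ {ρ γ₁ γ₂ φ ψ} → AlphaRel ρ φ ψ → Agree ρ γ₁ γ₂ →
                         ⟦_⟧ 𝓜 φ γ₁ ≡ ⟦_⟧ 𝓜 ψ γ₂
  ⟦⟧-respects-AlphaRel (avar r)  agree = agree r
  ⟦⟧-respects-AlphaRel acon      agree = refl
  ⟦⟧-respects-AlphaRel a⊤        agree = refl
  ⟦⟧-respects-AlphaRel a⊥        agree = refl
  ⟦⟧-respects-AlphaRel (a¬ α)    agree = ≡.cong f¬ (⟦⟧-respects-AlphaRel α agree)
  ⟦⟧-respects-AlphaRel (a⇒ α β)  agree =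
    ≡.cong₂ f→ (⟦⟧-respects-AlphaRel α agree) (⟦⟧-respects-AlphaRel β agree)
  ⟦⟧-respects-AlphaRel (a∨ α β)  agree =
    ≡.cong₂ f∨ (⟦⟧-respects-AlphaRel α agree) (⟦⟧-respects-AlphaRel β agree)
  ⟦⟧-respects-AlphaRel (a∧ α β)  agree =
    ≡.cong₂ f∧ (⟦⟧-respects-AlphaRel α agree) (⟦⟧-respects-AlphaRel β agree)
  ⟦⟧-respects-AlphaRel (a≡ α β)  agree =
    ≡.cong₂ f≡ (⟦⟧-respects-AlphaRel α agree) (⟦⟧-respects-AlphaRel β agree)
  ⟦⟧-respects-AlphaRel (a□ α)    agree = ≡.cong f□ (⟦⟧-respects-AlphaRel α agree)
  ⟦⟧-respects-AlphaRel (a∀ {x = x} {y = y} α) agree =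
    f∀-ext λ m → ⟦⟧-respects-AlphaRel α (Agree-update x y m agree)

  ⟦⟧-respects-=α : ∀ {γ φ ψ} → φ =α ψ → ⟦_⟧ 𝓜 φ γ ≡ ⟦_⟧ 𝓜 ψ γ
  ⟦⟧-respects-=α α = ⟦⟧-respects-AlphaRel α Agree-[]

module S3Model {C : Set} (𝓜 : PropDomain C) (S : IsS3Model 𝓜) where
  open PropDomain 𝓜
  open IsS3Model S

  f≡-true⇔≡ : ∀ {a b} → TRUE (f≡ a b) ⇔ (a ≡ b)
  f≡-true⇔≡ = ≡-truth _ _

  ≈ᵢ-isFmCongruence : ∀ γ → IsFmCongruence (≈ᵢ 𝓜 γ)
  ≈ᵢ-isFmCongruence γ = record
    { isEquivalence = record
        { refl  = λ _ → from f≡-true⇔≡ refl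
        ; sym   = λ p → from f≡-true⇔≡ (≡.sym (to f≡-true⇔≡ p))
        ; trans = λ p q → from f≡-true⇔≡ (≡.trans (to f≡-true⇔≡ p) (to f≡-true⇔≡ q))
        }
    ; ¬-cong = identity-cong f¬
    ; ∨-cong = identity-cong₂ f∨
    ; ∧-cong = identity-cong₂ f∧
    ; ⇒-cong = identity-cong₂ f→
    ; □-cong = identity-cong f□
    ; ≡-cong = identity-cong₂ f≡
    }
    where
    identity-cong : ∀ (f : M → M) {a a'} → TRUE (f≡ a a') → TRUE (f≡ (f a) (f a'))
    identity-cong f p = from f≡-true⇔≡ (≡.cong f (to f≡-true⇔≡ p))

    identity-cong₂ : ∀ (f : M → M → M) {a a' b b'} → TRUE (f≡ a a') → TRUE (f≡ b b') →
                     TRUE (f≡ (f a b) (f a' b'))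
    identity-cong₂ f p q = from f≡-true⇔≡ (≡.cong₂ f (to f≡-true⇔≡ p) (to f≡-true⇔≡ q))

  =α⇒≈ᵢ : ∀ γ {φ ψ} → φ =α ψ → ≈ᵢ 𝓜 γ φ ψ
  =α⇒≈ᵢ γ α = from f≡-true⇔≡ (AlphaInvariance.⟦⟧-respects-=α 𝓜 α)

  strict-true⇔≈M : ∀ {a b} → TRUE (f∧ (f□ (f→ a b)) (f□ (f→ b a))) ⇔ _≈M_ 𝓜 a b
  strict-true⇔≈M = mk⇔
    (λ t → let (p , q) = to (∧-truth _ _) t in to (□-truth _) p , to (□-truth _) q)
    (λ (p , q) → from (∧-truth _ _) (from (□-truth _) p , from (□-truth _) q))

  module _ (normal : Normal 𝓜) where
    open IsPreorder (preorder normal) using (reflexive) renaming (trans to ≤M-trans)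

    ≈M-reflexive : ∀ {a b} → a ≡ b → _≈M_ 𝓜 a b
    ≈M-reflexive a≡b = reflexive a≡b , reflexive (≡.sym a≡b)

    ≈ₛ-isEquivalence : ∀ γ → IsEquivalenceRel (≈ₛ 𝓜 γ)
    ≈ₛ-isEquivalence γ = record
      { refl  = λ _ → from strict-true⇔≈M (≈M-reflexive refl)
      ; sym   = λ p → from strict-true⇔≈M (swap (to strict-true⇔≈M p))
      ; trans = λ p q →
          let (φ≤ψ , ψ≤φ) = to strict-true⇔≈M p ; (ψ≤χ , χ≤ψ) = to strict-true⇔≈M q
          in from strict-true⇔≈M (≤M-trans φ≤ψ ψ≤χ , ≤M-trans χ≤ψ ψ≤φ)
      }

    ≡'⇒strictEquiv-true : ∀ γ φ ψ → _⊨_ 𝓜 γ ((φ ≡' ψ) ⇒ strictEquiv φ ψ)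
    ≡'⇒strictEquiv-true γ φ ψ = from (→-truth _ _) λ p → from strict-true⇔≈M (≈M-reflexive (to f≡-true⇔≡ p))

open S3Model using (=α⇒≈ᵢ; ≈ᵢ-isFmCongruence; ≈ₛ-isEquivalence; ≡'⇒strictEquiv-true)

lemma29 : (C : Set) →
    ((𝓜 : PropDomain C) → IsS3Model 𝓜 → Normal 𝓜 → (γ : Assignment 𝓜) →
      (IsFmCongruence (≈ᵢ 𝓜 γ) × (∀ {φ ψ : Fm C} → φ =α ψ → ≈ᵢ 𝓜 γ φ ψ))
      × IsEquivalenceRel (≈ₛ 𝓜 γ))
    × ((φ ψ : Fm C) → ⊩₃ ((φ ≡' ψ) ⇒ strictEquiv φ ψ))
lemma29 C =
  (λ 𝓜 S normal γ →
     (≈ᵢ-isFmCongruence 𝓜 S γ , =α⇒≈ᵢ 𝓜 S γ)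
     , ≈ₛ-isEquivalence 𝓜 S normal γ)
  , λ φ ψ 𝓜 S normal γ → ≡'⇒strictEquiv-true 𝓜 S normal γ φ ψ
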